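{- There exist a finite tree $G$, a weight distribution $w\in\mathbb{R}_{\geq0}^{V(G)}$, and a vertex $v\in V(G)$ such that for every $(w,v)$-optimal sequence of sharing moves $(T_1,\ldots,T_m)$, there are indices $i,j$ with $1\leq i<j\leq m$ such that $T_i\subseteq T_j$.
   Context: A weight distribution on $G$ is $w\in\mathbb{R}_{\geq 0}^{V(G)}$; $w(S)=\sum_{x\in S}w(x)$. A sharing move is a finite nonempty $T\subseteq V(G)$ inducing a connected subgraph; applying it replaces $w(x)$ by $w(T)/|T|$ for each $x\in T$ and leaves other values unchanged. $\mathcal{R}(w)$ is the set of weight distributions obtainable from $w$ by finite sequences of sharing moves, and $w^*(v)=\sup\{w'(v)\mid w'\in\mathcal{R}(w)\}$. A finite sequence $(T_1,\ldots,T_m)$ of sharing moves is $(w,v)$-optimal if the weight distribution $w'$ obtained from $w$ by applying $T_1,\ldots,T_m$ in order satisfies $w'(v)=w^*(v)$. -}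

module Defs where

open import Data.Nat as ℕ using (ℕ; zero; suc; _≤_)
open import Data.Integer using (+_)
open import Data.Rational using (ℚ; 0ℚ; _+_; _*_; _/_)
open import Data.Bool using (Bool; true; false; if_then_else_)
open import Data.Fin using (Fin; zero; suc)
open import Data.Fin.Subset using (Subset; _∈_; ∣_∣; Nonempty; ⊤)
open import Data.Vec using (Vec; []; _∷_)
open import Data.List using (List; []; _∷_; _∷ʳ_; length; foldl)
open import Data.List.Relation.Unary.Linked using (Linked)
open import Data.List.Relation.Unary.Unique.Propositional using (Unique)
open import Data.Product using (Σ; ∃; _×_)
open import Relation.Binary.PropositionalEquality using (_≡_)
open import Relation.Nullary using (¬_)

record SimpleGraph (n : ℕ) : Set where
  field
    adj     : Fin n → Fin n → Bool
    symm    : ∀ x y → adj x y ≡ adj y x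
    irrefl  : ∀ x → adj x x ≡ false

module _ {n : ℕ} (G : SimpleGraph n) where
  open SimpleGraph G

  Adj : Fin n → Fin n → Set
  Adj x y = adj x y ≡ true

  data WalkIn (S : Subset n) : Fin n → Fin n → Set where
    here : ∀ {x} → x ∈ S → WalkIn S x x
    step : ∀ {x y z} → x ∈ S → Adj x y → WalkIn S y z → WalkIn S x z

  InducesConnected : Subset n → Set
  InducesConnected S = ∀ x y → x ∈ S → y ∈ S → WalkIn S x y

  HasCycle : Set
  HasCycle = ∃ λ (x : Fin n) → ∃ λ (xs : List (Fin n)) →
    Unique (x ∷ xs) × 2 ≤ length xs × Linked Adj ((x ∷ xs) ∷ʳ x)

  IsTree : Set
  IsTree = 1 ≤ n × InducesConnected ⊤ × ¬ HasCycle

  IsSharingMove : Subset n → Set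
  IsSharingMove T = Nonempty T × InducesConnected T

Weight : ℕ → Set
Weight n = Fin n → ℚ

NonNeg : ∀ {n} → Weight n → Set
NonNeg w = ∀ x → 0ℚ Data.Rational.≤ w x

wsum : ∀ {n} → Weight n → Subset n → ℚ
wsum {zero}  w []      = 0ℚ
wsum {suc n} w (b ∷ S) = (if b then w zero else 0ℚ) + wsum (λ x → w (suc x)) S

-- 1 / k (only used with k = |T| ≥ 1)
inv : ℕ → ℚ
inv zero    = 0ℚ
inv (suc k) = (+ 1) / suc k

isIn : ∀ {n} → Subset n → Fin n → Bool
isIn (b ∷ S) zero    = b
isIn (b ∷ S) (suc x) = isIn S x

applyMove : ∀ {n} → Subset n → Weight n → Weight n
applyMove T w x = if isIn T x then wsum w T * inv ∣ T ∣ else w x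

applyMoves : ∀ {n} → List (Subset n) → Weight n → Weight n
applyMoves ts w = foldl (λ w' T → applyMove T w') w ts

module _ {n : ℕ} (G : SimpleGraph n) where
  open import Data.List.Relation.Unary.All using (All)

  ValidSeq : List (Subset n) → Set
  ValidSeq ts = All (IsSharingMove G) ts

  -- (w,v)-optimal: the final value at v equals w*(v) = sup over R(w),
  -- i.e. it is ≥ the value at v of every reachable distribution.
  Optimal : Weight n → Fin n → List (Subset n) → Set
  Optimal w v ts = ValidSeq ts ×
    (∀ us → ValidSeq us → applyMoves us w v Data.Rational.≤ applyMoves ts w v)

-- Take the star with centre 0 and leaves 1, 2, 3, weights w = (2, 0, 1, 1) and v = 1.
-- Sharing {0,2}, then {0,1,3}, then {0,1,2} brings 19/18 to v, so every optimal sequence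
-- leaves at least 19/18 at v. In a star a connected vertex set either contains the centre
-- or is a single leaf, and sharing on a singleton changes nothing. A sequence with no
-- T_i ⊆ T_j (i < j) therefore amounts to a sequence of distinct moves through the
-- centre in which no move contains an earlier one; there are finitely many such
-- sequences, and an exhaustive search shows that each leaves strictly less than 19/18
-- at v.
{-# OPTIONS --safe #-}
module Submission where

open import Defs
open import Data.Nat using (ℕ; zero; suc; s≤s; z≤n)
open import Data.Fin using (Fin; _<_; zero; suc)
open import Data.Fin.Subset using (Subset; _⊆_; _∈_; _∉_; ⊥; ⁅_⁆; ∣_∣; inside; outside)
open import Data.Fin.Subset.Properties using (_∈?_; _⊆?_; ∈⊤; x∈⁅x⁆; x∈⁅y⁆⇒x≡y; ∣⁅x⁆∣≡1; ⊆-antisym)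
open import Data.List using (List; length; lookup; []; _∷_; map; _++_)
open import Data.List.Membership.Propositional using () renaming (_∈_ to _∈ₗ_)
open import Data.List.Membership.Propositional.Properties using (∈-map⁺; ∈-++⁺ˡ; ∈-++⁺ʳ)
open import Data.List.Relation.Unary.All as All using (All; []; _∷_; all?)
open import Data.List.Relation.Unary.Any as Any using (Any; here; there; any?)
open import Data.List.Relation.Unary.Linked using (_∷_)
open import Data.List.Relation.Unary.AllPairs using (_∷_)
open import Data.Product using (Σ; ∃; _×_; _,_)
open import Data.Sum using (_⊎_; inj₁; inj₂; fromInj₁)
import Data.Sum as Sum
open import Data.Bool using (Bool; true; false; if_then_else_)
open import Data.Vec as Vec using (Vec; []; _∷_; here; there; tabulate)
open import Data.Vec.Properties using (lookup∘tabulate)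
open import Data.Vec.Relation.Unary.All.Properties using (lookup⁺)
import Data.Vec.Relation.Unary.All as VecAll
open import Data.Empty using (⊥-elim)
import Data.Empty as Empty
open import Data.Integer using (+_)
open import Data.Rational using (ℚ; 0ℚ; 1ℚ; _+_; _*_; _/_)
open import Data.Rational.Properties using (_<?_; _≤?_; <-irrefl; <-≤-trans; +-identityˡ; +-identityʳ; *-identityʳ)
import Data.Rational as ℚ
open import Relation.Nullary using (¬_; Dec; yes; no)
open import Relation.Nullary.Decidable using (_×-dec_; _⊎-dec_; from-yes)
open import Relation.Binary.PropositionalEquality using (_≡_; _≗_; refl; sym; trans; cong; cong₂; subst; module ≡-Reasoning)

NestedPair : ∀ {n} → List (Subset n) → Set
NestedPair ts = ∃ λ (i : Fin (length ts)) → ∃ λ (j : Fin (length ts)) → i < j × lookup ts i ⊆ lookup ts j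

-- H lists the moves made so far, most recent first.
NestedAfter : ∀ {n} → List (Subset n) → List (Subset n) → Set
NestedAfter H ts = Any (λ h → ∃ λ j → h ⊆ lookup ts j) H ⊎ NestedPair ts

module _ {n : ℕ} {T : Subset n} {ts : List (Subset n)} where

  nestedAfter-here : ∀ {H} → Any (_⊆ T) H → NestedAfter H (T ∷ ts)
  nestedAfter-here h⊆T = inj₁ (Any.map (zero ,_) h⊆T)

  nestedAfter-skip : ∀ {H} → NestedAfter H ts → NestedAfter H (T ∷ ts)
  nestedAfter-skip (inj₁ h⊆) = inj₁ (Any.map later h⊆)
    where
    later : ∀ {h} → ∃ (λ j → h ⊆ lookup ts j) → ∃ λ j → h ⊆ lookup (T ∷ ts) j
    later (j , h⊆tⱼ) = suc j , h⊆tⱼ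
  nestedAfter-skip (inj₂ (i , j , i<j , tᵢ⊆tⱼ)) = inj₂ (suc i , suc j , s≤s i<j , tᵢ⊆tⱼ)

  nestedAfter-push : ∀ {H} → NestedAfter (T ∷ H) ts → NestedAfter H (T ∷ ts)
  nestedAfter-push (inj₁ (here (j , T⊆tⱼ))) = inj₂ (zero , suc j , s≤s z≤n , T⊆tⱼ)
  nestedAfter-push (inj₁ (there h⊆)) = nestedAfter-skip (inj₁ h⊆)
  nestedAfter-push (inj₂ nested) = nestedAfter-skip (inj₂ nested)

nestedAfter-[] : ∀ {n} {ts : List (Subset n)} → NestedAfter [] ts → NestedPair ts
nestedAfter-[] (inj₂ nested) = nested

isIn⇒∈ : ∀ {n} (T : Subset n) x → isIn T x ≡ true → x ∈ T
isIn⇒∈ (true ∷ T) zero refl = here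
isIn⇒∈ (_ ∷ T) (suc x) isIn≡true = there (isIn⇒∈ T x isIn≡true)

wsum-⊥ : ∀ {n} (w : Weight n) → wsum w ⊥ ≡ 0ℚ
wsum-⊥ {zero} w = refl
wsum-⊥ {suc n} w = trans (+-identityˡ _) (wsum-⊥ (λ x → w (suc x)))

wsum-⁅⁆ : ∀ {n} (w : Weight n) x → wsum w ⁅ x ⁆ ≡ w x
wsum-⁅⁆ w zero = trans (cong (λ q → w zero + q) (wsum-⊥ (λ y → w (suc y)))) (+-identityʳ (w zero))
wsum-⁅⁆ w (suc x) = trans (+-identityˡ _) (wsum-⁅⁆ (λ y → w (suc y)) x)

applyMove-⁅⁆ : ∀ {n} (x : Fin n) (w : Weight n) → applyMove ⁅ x ⁆ w ≗ w
applyMove-⁅⁆ x w y with isIn ⁅ x ⁆ y in y∈⁅x⁆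
... | false = refl
... | true = begin
  wsum w ⁅ x ⁆ * inv ∣ ⁅ x ⁆ ∣  ≡⟨ cong₂ _*_ (wsum-⁅⁆ w x) (cong inv (∣⁅x⁆∣≡1 x)) ⟩
  w x * 1ℚ                     ≡⟨ *-identityʳ (w x) ⟩
  w x                          ≡⟨ cong w (sym (x∈⁅y⁆⇒x≡y x (isIn⇒∈ ⁅ x ⁆ y y∈⁅x⁆))) ⟩
  w y                          ∎
  where open ≡-Reasoning

wsum-cong : ∀ {n} {w w′ : Weight n} → w ≗ w′ → ∀ S → wsum w S ≡ wsum w′ S
wsum-cong {zero} w≗w′ [] = refl
wsum-cong {suc n} w≗w′ (b ∷ S) =
  cong₂ (λ p q → (if b then p else 0ℚ) + q) (w≗w′ zero) (wsum-cong (λ x → w≗w′ (suc x)) S)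

applyMove-cong : ∀ {n} (T : Subset n) {w w′ : Weight n} → w ≗ w′ → applyMove T w ≗ applyMove T w′
applyMove-cong T w≗w′ x with isIn T x
... | true = cong (λ q → q * inv ∣ T ∣) (wsum-cong w≗w′ T)
... | false = w≗w′ x

subsets : (n : ℕ) → List (Subset n)
subsets zero    = [] ∷ []
subsets (suc n) = map (inside ∷_) (subsets n) ++ map (outside ∷_) (subsets n)

∈-subsets : ∀ {n} (S : Subset n) → S ∈ₗ subsets n
∈-subsets []          = here refl
∈-subsets (true ∷ S)  = ∈-++⁺ˡ (∈-map⁺ (inside ∷_) (∈-subsets S))
∈-subsets (false ∷ S) = ∈-++⁺ʳ _ (∈-map⁺ (outside ∷_) (∈-subsets S))

applyMoveᵥ : ∀ {n} → Subset n → Vec ℚ n → Vec ℚ n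
applyMoveᵥ T s = tabulate (applyMove T (Vec.lookup s))

module ExhaustiveSearch {n : ℕ} (moves : List (Subset n)) (v : Fin n) (bound : ℚ) where

  -- Certifies, for history H and current weights s, that every continuation by `moves`
  -- in which no move contains an earlier one ends below `bound` at v; k is search depth.
  StaysBelow : ℕ → List (Subset n) → Vec ℚ n → Set
  StaysBelow zero    H s = Empty.⊥
  StaysBelow (suc k) H s = Vec.lookup s v ℚ.< bound ×
    All (λ T → Any (_⊆ T) H ⊎ StaysBelow k (T ∷ H) (applyMoveᵥ T s)) moves

  staysBelow? : ∀ k H s → Dec (StaysBelow k H s)
  staysBelow? zero    H s = no λ ()
  staysBelow? (suc k) H s = (Vec.lookup s v <? bound) ×-dec
    all? (λ T → any? (_⊆? T) H ⊎-dec staysBelow? k (T ∷ H) (applyMoveᵥ T s)) moves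

  module _ (G : SimpleGraph n)
           (classify : ∀ {T} → IsSharingMove G T → T ∈ₗ moves ⊎ (∀ w → applyMove T w ≗ w)) where

    staysBelow-sound : ∀ {k H s} → StaysBelow k H s → ∀ ts {w} → w ≗ Vec.lookup s →
                       ValidSeq G ts → NestedAfter H ts ⊎ applyMoves ts w v ℚ.< bound
    staysBelow-sound {suc k} (below , _) [] w≗s [] = inj₂ (subst (ℚ._< bound) (sym (w≗s v)) below)
    staysBelow-sound {suc k} {H} {s} certificate@(_ , next) (T ∷ ts) {w} w≗s (T-move ∷ valid)
      with classify T-move
    ... | inj₂ T-id = Sum.map₁ nestedAfter-skip
            (staysBelow-sound {suc k} {H} {s} certificate ts (λ x → trans (T-id w x) (w≗s x)) valid)
    ... | inj₁ T∈moves with All.lookup next T∈moves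
    ...   | inj₁ H∋h⊆T = inj₁ (nestedAfter-here H∋h⊆T)
    ...   | inj₂ certificate′ = Sum.map₁ nestedAfter-push
            (staysBelow-sound certificate′ ts w≗s′ valid)
      where
      w≗s′ : applyMove T w ≗ Vec.lookup (applyMoveᵥ T s)
      w≗s′ x = trans (applyMove-cong T w≗s x) (sym (lookup∘tabulate (applyMove T (Vec.lookup s)) x))

star-adj : ∀ {k} → Fin (suc k) → Fin (suc k) → Bool
star-adj zero    zero    = false
star-adj zero    (suc _) = true
star-adj (suc _) zero    = true
star-adj (suc _) (suc _) = false

star : (k : ℕ) → SimpleGraph (suc k)
star k = record { adj = star-adj ; symm = symm ; irrefl = irrefl }
  where
  symm : ∀ x y → star-adj x y ≡ star-adj y x
  symm zero    zero    = refl
  symm zero    (suc _) = refl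
  symm (suc _) zero    = refl
  symm (suc _) (suc _) = refl

  irrefl : ∀ x → star-adj x x ≡ false
  irrefl zero    = refl
  irrefl (suc _) = refl

module _ {k : ℕ} where

  star-connected : ∀ {S} → zero ∈ S → InducesConnected (star k) S
  star-connected 0∈S zero    zero    x∈S y∈S = here x∈S
  star-connected 0∈S zero    (suc y) x∈S y∈S = step x∈S refl (here y∈S)
  star-connected 0∈S (suc x) zero    x∈S y∈S = step x∈S refl (here y∈S)
  star-connected 0∈S (suc x) (suc y) x∈S y∈S = step x∈S refl (step 0∈S refl (here y∈S))

  -- Consecutive vertices of a walk in a star alternate between the centre and leaves,
  -- so a cycle meets the centre twice within two steps.
  star-acyclic : ¬ HasCycle (star k)
  star-acyclic (_ , [] , _ , () , _)
  star-acyclic (_ , _ ∷ [] , _ , s≤s () , _)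
  star-acyclic (zero , zero ∷ _ , _ , _ , () ∷ _)
  star-acyclic (suc _ , suc _ ∷ _ , _ , _ , () ∷ _)
  star-acyclic (zero , suc _ ∷ zero ∷ _ , (_ ∷ x≢y₂ ∷ _) ∷ _ , _ , _) = x≢y₂ refl
  star-acyclic (zero , suc _ ∷ suc _ ∷ _ , _ , _ , _ ∷ () ∷ _)
  star-acyclic (suc _ , zero ∷ zero ∷ _ , _ , _ , _ ∷ () ∷ _)
  star-acyclic (suc _ , zero ∷ suc _ ∷ [] , _ , _ , _ ∷ _ ∷ () ∷ _)
  star-acyclic (suc _ , zero ∷ suc _ ∷ suc _ ∷ _ , _ , _ , _ ∷ _ ∷ () ∷ _)
  star-acyclic (suc _ , zero ∷ suc _ ∷ zero ∷ _ , _ ∷ (_ ∷ y₁≢y₃ ∷ _) ∷ _ , _ , _) = y₁≢y₃ refl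

  star-isTree : IsTree (star k)
  star-isTree = s≤s z≤n , star-connected ∈⊤ , star-acyclic

  star-walk-avoiding-centre : ∀ {T a b} → zero ∉ T → WalkIn (star k) T (suc a) (suc b) → a ≡ b
  star-walk-avoiding-centre 0∉T (here _) = refl
  star-walk-avoiding-centre 0∉T (step {y = zero} _ _ (step 0∈T _ _)) = ⊥-elim (0∉T 0∈T)
  star-walk-avoiding-centre 0∉T (step {y = suc _} _ () _)

  star-sharingMove : ∀ {T} → zero ∈ T → IsSharingMove (star k) T
  star-sharingMove 0∈T = (zero , 0∈T) , star-connected 0∈T

  star-sharingMove-cases : ∀ {T} → IsSharingMove (star k) T → zero ∈ T ⊎ ∃ λ x → T ≡ ⁅ x ⁆
  star-sharingMove-cases {T} ((x , x∈T) , connected) with zero ∈? T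
  ... | yes 0∈T = inj₁ 0∈T
  ... | no 0∉T with x
  ...   | zero  = ⊥-elim (0∉T x∈T)
  ...   | suc a = inj₂ (suc a , ⊆-antisym T⊆⁅x⁆ ⁅x⁆⊆T)
    where
    T⊆⁅x⁆ : T ⊆ ⁅ suc a ⁆
    T⊆⁅x⁆ {zero}  0∈T = ⊥-elim (0∉T 0∈T)
    T⊆⁅x⁆ {suc b} b∈T =
      subst (λ c → suc b ∈ ⁅ suc c ⁆) (star-walk-avoiding-centre 0∉T (connected _ _ b∈T x∈T)) (x∈⁅x⁆ _)
    ⁅x⁆⊆T : ⁅ suc a ⁆ ⊆ T
    ⁅x⁆⊆T y∈⁅x⁆ = subst (_∈ T) (sym (x∈⁅y⁆⇒x≡y _ y∈⁅x⁆)) x∈T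

  centredMoves : List (Subset (suc k))
  centredMoves = map (inside ∷_) (subsets k)

  star-classify : ∀ {T} → IsSharingMove (star k) T → T ∈ₗ centredMoves ⊎ (∀ w → applyMove T w ≗ w)
  star-classify move with star-sharingMove-cases move
  ... | inj₁ here = inj₁ (∈-map⁺ (inside ∷_) (∈-subsets _))
  ... | inj₂ (x , refl) = inj₂ (applyMove-⁅⁆ x)

weights₀ : Vec ℚ 4
weights₀ = + 2 / 1 ∷ 0ℚ ∷ 1ℚ ∷ 1ℚ ∷ []

w₀ : Weight 4
w₀ = Vec.lookup weights₀

w₀-nonneg : NonNeg w₀
w₀-nonneg = lookup⁺ (from-yes (VecAll.all? (0ℚ ≤?_) weights₀))

leaf : Fin 4
leaf = suc zero

optimalMoves : List (Subset 4)
optimalMoves = (inside ∷ outside ∷ inside  ∷ outside ∷ [])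
             ∷ (inside ∷ inside  ∷ outside ∷ inside  ∷ [])
             ∷ (inside ∷ inside  ∷ inside  ∷ outside ∷ [])
             ∷ []

optimalMoves-valid : ValidSeq (star 3) optimalMoves
optimalMoves-valid = All.map star-sharingMove (here ∷ here ∷ here ∷ [])

open ExhaustiveSearch centredMoves leaf (applyMoves optimalMoves w₀ leaf)

nestedPair-or-beaten : ∀ ts → ValidSeq (star 3) ts →
                       NestedPair ts ⊎ applyMoves ts w₀ leaf ℚ.< applyMoves optimalMoves w₀ leaf
nestedPair-or-beaten ts valid = Sum.map₁ (nestedAfter-[] {ts = ts})
  (staysBelow-sound (star 3) star-classify {9} {[]} {weights₀} certificate ts (λ _ → refl) valid)
  where
  -- No move occurs twice in a sequence without nested pairs, so the 8 centred moves
  -- give sequences of length at most 8. (The indices above are explicit because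
  -- inferring them would unfold the certificate.)
  certificate : StaysBelow 9 [] weights₀
  certificate = from-yes (staysBelow? 9 [] weights₀)

proposition6p2 : Σ ℕ λ n → Σ (SimpleGraph n) λ G → IsTree G × Σ (Weight n) λ w → NonNeg w × Σ (Fin n) λ v → (ts : List (Subset n)) → Optimal G w v ts → ∃ λ (i : Fin (length ts)) → ∃ λ (j : Fin (length ts)) → i < j × lookup ts i ⊆ lookup ts j
proposition6p2 = 4 , star 3 , star-isTree , w₀ , w₀-nonneg , leaf , nestedPair-if-optimal
  where
  nestedPair-if-optimal : ∀ ts → Optimal (star 3) w₀ leaf ts → NestedPair ts
  nestedPair-if-optimal ts (valid , optimal) = fromInj₁
    (λ beaten → ⊥-elim (<-irrefl refl (<-≤-trans beaten (optimal optimalMoves optimalMoves-valid))))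
    (nestedPair-or-beaten ts valid)
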